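{- For all $n\geq 1$, some maximizer of $P$ over $NC(n)$ lies in $W(n)$. Consequently, every maximizer of $P$ over $W(n)$ is a maximizer of $P$ over $NC(n)$.
   Context: A multigraph is $(V,w)$ with $w:\binom V2\to\mathbb{N}$; $\mu(G)=\max w$, $P(G)=\prod w$. An $(s,q)$-graph is one in which every $s$ vertices span total multiplicity at most $q$; $F(n,s,q)$ is the set of $(s,q)$-graphs on $[n]$. $D(n)=\{G\in F(n,4,15):\mu(G)\le 3\}\cap F(n,3,8)$. An $(i,j,k)$-triangle is a 3-set of vertices whose multiset of pair multiplicities is $\{i,j,k\}$. $C(n)$ is the set of $G\in D(n)$ with no $(3,1,1)$-, $(2,1,1)$- or $(3,2,1)$-triangle. For $t\ge3$, $C_t(3,2)=([t],w)$ with $w=3$ on the consecutive pairs $12,23,\dots,(t-1)t,t1$ and $w=2$ on all other pairs. $NC(n)$ is the set of $G\in C(n)$ containing no induced copy of $C_t(3,2)$ for any $t\ge3$. $W(n)$ is the set of $([n],w)$ for which there is a partition $L,R$ of $[n]$ with $w=1$ on $\binom L2$, $w=2$ on $\binom R2$, $w=3$ between $L$ and $R$. -}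

module Defs where

open import Data.Nat as ℕ using (ℕ; zero; suc; _+_; _*_; _≤_)
open import Data.Fin as Fin using (Fin; toℕ) renaming (zero to fz; suc to fs)
open import Data.Fin.Properties using () renaming (_<?_ to _<ᶠ?_)
open import Data.List using (tabulate)
open import Data.Nat.ListAction using (product)
open import Data.Product using (_×_; Σ; ∃; ∃-syntax; _,_)
open import Data.Sum using (_⊎_)
open import Data.Bool using (Bool; true; false)
open import Relation.Nullary using (¬_; yes; no)
open import Relation.Binary.PropositionalEquality using (_≡_; _≢_)
open import Function.Definitions using (Injective)

-- A multigraph on [n] = Fin n.  The weight of the pair {i,j} (i < j) is
-- w i j; the values w i j with ¬ (i < j) are irrelevant and never used.
Graph : ℕ → Set
Graph n = Fin n → Fin n → ℕ

wt : ∀ {n} → Graph n → Fin n → Fin n → ℕ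
wt w i j with i <ᶠ? j
... | yes _ = w i j
... | no _  = w j i

-- P(G) = product over all pairs i < j of w i j
P : ∀ {n} → Graph n → ℕ
P {zero}  w = 1
P {suc n} w = product (tabulate (λ (j : Fin n) → w fz (fs j)))
            * P {n} (λ i j → w (fs i) (fs j))

Is38 : ∀ {n} → Graph n → Set
Is38 {n} w = ∀ (i j k : Fin n) → i Fin.< j → j Fin.< k →
  w i j + w i k + w j k ≤ 8

Is415 : ∀ {n} → Graph n → Set
Is415 {n} w = ∀ (i j k l : Fin n) → i Fin.< j → j Fin.< k → k Fin.< l →
  w i j + w i k + w i l + w j k + w j l + w k l ≤ 15

MuLe3 : ∀ {n} → Graph n → Set
MuLe3 {n} w = ∀ (i j : Fin n) → i Fin.< j → w i j ≤ 3

InD : ∀ {n} → Graph n → Set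
InD w = Is415 w × MuLe3 w × Is38 w

SameMultiset : ℕ → ℕ → ℕ → ℕ → ℕ → ℕ → Set
SameMultiset a b c x y z =
  (a ≡ x × b ≡ y × c ≡ z) ⊎ (a ≡ x × b ≡ z × c ≡ y) ⊎
  (a ≡ y × b ≡ x × c ≡ z) ⊎ (a ≡ y × b ≡ z × c ≡ x) ⊎
  (a ≡ z × b ≡ x × c ≡ y) ⊎ (a ≡ z × b ≡ y × c ≡ x)

HasTriangle : ∀ {n} → Graph n → ℕ → ℕ → ℕ → Set
HasTriangle {n} w x y z = Σ (Fin n) λ i → Σ (Fin n) λ j → Σ (Fin n) λ k →
  i Fin.< j × j Fin.< k × SameMultiset (w i j) (w i k) (w j k) x y z

InC : ∀ {n} → Graph n → Set
InC w = InD w × ¬ HasTriangle w 3 1 1 × ¬ HasTriangle w 2 1 1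
              × ¬ HasTriangle w 3 2 1

Next : (t : ℕ) → Fin t → Fin t → Set
Next t a b = suc (toℕ a) ≡ toℕ b ⊎ (suc (toℕ a) ≡ t × toℕ b ≡ 0)

Consec : (t : ℕ) → Fin t → Fin t → Set
Consec t a b = Next t a b ⊎ Next t b a

InducedCt32 : ∀ {n} → Graph n → (t : ℕ) → (Fin t → Fin n) → Set
InducedCt32 w t f = Injective _≡_ _≡_ f ×
  (∀ (a b : Fin t) → a ≢ b →
     (Consec t a b → wt w (f a) (f b) ≡ 3) ×
     (¬ Consec t a b → wt w (f a) (f b) ≡ 2))

InNC : ∀ {n} → Graph n → Set
InNC {n} w = InC w ×
  ¬ (Σ ℕ λ t → 3 ≤ t × Σ (Fin t → Fin n) λ f → InducedCt32 w t f)

-- W(n): partition [n] = L ∪ R, encoded by side : Fin n → Bool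
-- (true = L, false = R); either part may be empty
SideWeight : Bool → Bool → ℕ
SideWeight true  true  = 1
SideWeight false false = 2
SideWeight true  false = 3
SideWeight false true  = 3

InW : ∀ {n} → Graph n → Set
InW {n} w = Σ (Fin n → Bool) λ side →
  ∀ (i j : Fin n) → i Fin.< j → w i j ≡ SideWeight (side i) (side j)

IsMaximizer : ∀ {n} → (Graph n → Set) → Graph n → Set
IsMaximizer {n} S G = S G × (∀ (H : Graph n) → S H → P H ≤ P G)

-- We may assume all weights positive (otherwise P = 0), so they lie in {1,2,3}.
-- Excluding (2,1,1)-, (3,1,1)- and (3,2,1)-triangles makes "equal or joined by a 1-edge" an
-- equivalence relation; let m be the size of a largest class. If every vertex of a set S had
-- more than m 3-neighbours in S, there would be a walk along 3-edges never returning to a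
-- class two steps later, and its first chord that is not a 2-edge would close an induced
-- C_t(3,2). So some vertex has 3-degree at most m, and deleting it and inducting gives
-- e₃ ≤ m (n − m) and e₁ ≥ m (m − 1) / 2. As P = 2^e₂ 3^e₃, the graph of W(n) with |L| = m,
-- which attains both bounds, has P at least as large. Since W(n) ⊆ NC(n), a maximiser of P
-- among the n + 1 split graphs maximises P over NC(n), and so does every maximiser over W(n).

module Submission where

open import Defs
open import Data.Bool as Bool using (Bool; true; false; _∧_; _∨_; not; if_then_else_)
open import Data.Bool.Properties using (∧-identityʳ; ∧-zeroʳ; ∧-assoc; ∧-inverseʳ; ∧-commutativeMonoid)
open import Algebra.Bundles using (CommutativeMonoid)
open import Algebra.Properties.CommutativeSemigroup (CommutativeMonoid.commutativeSemigroup ∧-commutativeMonoid)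
  using () renaming (xy∙z≈xz∙y to ∧-exchange)
open import Data.Empty using (⊥; ⊥-elim)
open import Data.Fin as Fin using (Fin; toℕ) renaming (zero to fz; suc to fs)
import Data.Fin.Properties as Finₚ
open import Data.Nat
open import Data.Nat.Properties
open import Data.Nat.ListAction using (product)
open import Data.List using (tabulate)
open import Algebra.Properties.CommutativeMonoid.Sum +-0-commutativeMonoid
  using (sum; sum-cong-≗; ∑-distrib-+)
open import Algebra.Properties.CommutativeSemigroup +-commutativeSemigroup using () renaming (x∙yz≈y∙xz to +-exchange)
open import Data.Product using (Σ; ∃; _×_; _,_; proj₁; proj₂)
open import Data.Nat.Solver using (module +-*-Solver)
open +-*-Solver using (solve; _:+_; _:*_; _:=_; con)
open import Data.Sum using (_⊎_; inj₁; inj₂)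
open import Function using (_∘_)
open import Relation.Binary using (tri<; tri≈; tri>)
open import Relation.Binary.PropositionalEquality
open import Relation.Nullary using (¬_; Dec; yes; no; does; contradiction)
open import Relation.Nullary.Decidable
  using (dec-true; dec-false; from-yes; False; toWitnessFalse; _×-dec_; _⊎-dec_; ¬?; decidable-stable)
open import Relation.Unary using (Decidable)

-- Counting over subsets of Fin n

does-true⇒ : ∀ {a} {A : Set a} (d : Dec A) → does d ≡ true → A
does-true⇒ (yes a) _ = a

does-false⇒ : ∀ {a} {A : Set a} (d : Dec A) → does d ≡ false → ¬ A
does-false⇒ (no ¬a) _ = ¬a

_=ᶠ_ : ∀ {n} → Fin n → Fin n → Bool
x =ᶠ y = does (x Finₚ.≟ y)

_=ℕ_ : ℕ → ℕ → Bool
u =ℕ v = does (u ≟ v)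

=ᶠ-refl : ∀ {n} (x : Fin n) → (x =ᶠ x) ≡ true
=ᶠ-refl x = dec-true (x Finₚ.≟ x) refl

∧-true⇒ : ∀ {a b} → a ∧ b ≡ true → a ≡ true × b ≡ true
∧-true⇒ {true} {true} _ = refl , refl

not-true⇒ : ∀ {b} → not b ≡ true → b ≡ false
not-true⇒ {false} _ = refl

bit : Bool → ℕ
bit true  = 1
bit false = 0

count : ∀ {n} → (Fin n → Bool) → ℕ
count S = sum (bit ∘ S)

∑∈ : ∀ {n} → (Fin n → Bool) → (Fin n → ℕ) → ℕ
∑∈ S g = sum (λ x → if S x then g x else 0)

remove : ∀ {n} → Fin n → (Fin n → Bool) → Fin n → Bool
remove x S y = S y ∧ not (x =ᶠ y)

count-cong : ∀ {n} {S T : Fin n → Bool} → (∀ y → S y ≡ T y) → count S ≡ count T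
count-cong e = sum-cong-≗ (cong bit ∘ e)

sum-mono : ∀ {n} {f g : Fin n → ℕ} → (∀ y → f y ≤ g y) → sum f ≤ sum g
sum-mono {zero}  _   = z≤n
sum-mono {suc n} f≤g = +-mono-≤ (f≤g fz) (sum-mono (f≤g ∘ fs))

count-≤ : ∀ {n} (S : Fin n → Bool) → count S ≤ n
count-≤ {zero}  S = z≤n
count-≤ {suc n} S with S fz
... | true  = s≤s (count-≤ (S ∘ fs))
... | false = m≤n⇒m≤1+n (count-≤ (S ∘ fs))

count-empty : ∀ {n} (S : Fin n → Bool) → (∀ y → S y ≡ false) → count S ≡ 0
count-empty {zero}  S h = refl
count-empty {suc n} S h rewrite h fz = count-empty (S ∘ fs) (h ∘ fs)

count-mono : ∀ {n} {S T : Fin n → Bool} → (∀ y → S y ≡ true → T y ≡ true) → count S ≤ count T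
count-mono {S = S} {T} S⊆T = sum-mono pointwise
  where
  pointwise : ∀ y → bit (S y) ≤ bit (T y)
  pointwise y with S y in Sy | T y in Ty
  ... | false | _     = z≤n
  ... | true  | true  = ≤-refl
  ... | true  | false = contradiction (trans (sym (S⊆T y Sy)) Ty) λ ()

count-<⇒∃ : ∀ {n} (S T : Fin n → Bool) → count T < count S → ∃ λ y → S y ≡ true × T y ≡ false
count-<⇒∃ S T T<S with Finₚ.any? (λ y → (S y Bool.≟ true) ×-dec (T y Bool.≟ false))
... | yes found = found
... | no none   = contradiction (count-mono S⊆T) (<⇒≱ T<S)
  where
  S⊆T : ∀ y → S y ≡ true → T y ≡ true
  S⊆T y Sy with T y in Ty
  ... | true  = refl
  ... | false = ⊥-elim (none (y , Sy , Ty))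

count-disjoint-∪ : ∀ {n} (S T U : Fin n → Bool) →
  (∀ y → S y ≡ true → U y ≡ true) → (∀ y → T y ≡ true → U y ≡ true) →
  (∀ y → S y ≡ true → T y ≡ false) → count S + count T ≤ count U
count-disjoint-∪ S T U S⊆U T⊆U S∩T = subst (_≤ count U) (∑-distrib-+ (bit ∘ S) (bit ∘ T)) (sum-mono pointwise)
  where
  pointwise : ∀ y → bit (S y) + bit (T y) ≤ bit (U y)
  pointwise y with S y in Sy | T y in Ty
  ... | false | false = z≤n
  ... | true  | false = ≤-reflexive (cong bit (sym (S⊆U y Sy)))
  ... | false | true  = ≤-reflexive (cong bit (sym (T⊆U y Ty)))
  ... | true  | true  = contradiction (trans (sym (S∩T y Sy)) Ty) λ ()

count-remove : ∀ {n} (x : Fin n) (S : Fin n → Bool) →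
  count S ≡ bit (S x) + count (remove x S)
count-remove {suc n} fz S
  rewrite ∧-zeroʳ (S fz) = cong (bit (S fz) +_) (count-cong (λ y → sym (∧-identityʳ (S (fs y)))))
count-remove {suc n} (fs x) S
  rewrite ∧-identityʳ (S fz) | count-remove x (S ∘ fs) = +-exchange (bit (S fz)) (bit (S (fs x))) _

count-remove-member : ∀ {n} {x : Fin n} (S : Fin n → Bool) → S x ≡ true → count S ≡ suc (count (remove x S))
count-remove-member {x = x} S Sx = trans (count-remove x S) (cong (λ b → bit b + count (remove x S)) Sx)

count-singleton : ∀ {n} (x : Fin n) → count (x =ᶠ_) ≡ 1
count-singleton x rewrite count-remove x (x =ᶠ_) | =ᶠ-refl x =
  cong suc (count-empty _ (λ y → ∧-inverseʳ (x =ᶠ y)))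

∑∈-cong : ∀ {n} (S : Fin n → Bool) {f g : Fin n → ℕ} →
  (∀ y → S y ≡ true → f y ≡ g y) → ∑∈ S f ≡ ∑∈ S g
∑∈-cong S {f} {g} e = sum-cong-≗ pointwise
  where
  pointwise : ∀ y → (if S y then f y else 0) ≡ (if S y then g y else 0)
  pointwise y with S y in eS
  ... | true  = e y eS
  ... | false = refl

∑∈-empty : ∀ {n} (S : Fin n → Bool) g → (∀ y → S y ≡ false) → ∑∈ S g ≡ 0
∑∈-empty {zero}  S g h = refl
∑∈-empty {suc n} S g h rewrite h fz = ∑∈-empty (S ∘ fs) (g ∘ fs) (h ∘ fs)

∑∈-+ : ∀ {n} (S : Fin n → Bool) (f g : Fin n → ℕ) →
  ∑∈ S (λ y → f y + g y) ≡ ∑∈ S f + ∑∈ S g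
∑∈-+ S f g = trans (sum-cong-≗ pointwise) (∑-distrib-+ (λ y → if S y then f y else 0) (λ y → if S y then g y else 0))
  where
  pointwise : ∀ y → (if S y then f y + g y else 0) ≡ (if S y then f y else 0) + (if S y then g y else 0)
  pointwise y with S y
  ... | true  = refl
  ... | false = refl

∑∈-indicator : ∀ {n} (S T : Fin n → Bool) → ∑∈ S (bit ∘ T) ≡ count (λ y → S y ∧ T y)
∑∈-indicator S T = sum-cong-≗ pointwise
  where
  pointwise : ∀ y → (if S y then bit (T y) else 0) ≡ bit (S y ∧ T y)
  pointwise y with S y
  ... | true  = refl
  ... | false = refl

∑∈-remove : ∀ {n} (x : Fin n) (S : Fin n → Bool) (g : Fin n → ℕ) → S x ≡ true →
  ∑∈ S g ≡ g x + ∑∈ (remove x S) g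
∑∈-remove {suc n} fz S g Sx
  rewrite Sx = cong (g fz +_) (sum-cong-≗ pointwise)
  where
  pointwise : ∀ y → (if S (fs y) then g (fs y) else 0) ≡ (if S (fs y) ∧ true then g (fs y) else 0)
  pointwise y rewrite ∧-identityʳ (S (fs y)) = refl
∑∈-remove {suc n} (fs x) S g Sx
  rewrite ∧-identityʳ (S fz) | ∑∈-remove x (S ∘ fs) (g ∘ fs) Sx =
  +-exchange (if S fz then g fz else 0) (g (fs x)) _

-- Triangles and degrees

sameMultiset? : ∀ a b c x y z → Dec (SameMultiset a b c x y z)
sameMultiset? a b c x y z =
  (a ≟ x ×-dec b ≟ y ×-dec c ≟ z) ⊎-dec (a ≟ x ×-dec b ≟ z ×-dec c ≟ y) ⊎-dec
  (a ≟ y ×-dec b ≟ x ×-dec c ≟ z) ⊎-dec (a ≟ y ×-dec b ≟ z ×-dec c ≟ x) ⊎-dec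
  (a ≟ z ×-dec b ≟ x ×-dec c ≟ y) ⊎-dec (a ≟ z ×-dec b ≟ y ×-dec c ≟ x)

SameMultiset-swap₁₂ : ∀ {a b c x y z} → SameMultiset a b c x y z → SameMultiset b a c x y z
SameMultiset-swap₁₂ (inj₁ (p , q , r))                               = inj₂ (inj₂ (inj₁ (q , p , r)))
SameMultiset-swap₁₂ (inj₂ (inj₁ (p , q , r)))                        = inj₂ (inj₂ (inj₂ (inj₂ (inj₁ (q , p , r)))))
SameMultiset-swap₁₂ (inj₂ (inj₂ (inj₁ (p , q , r))))                 = inj₁ (q , p , r)
SameMultiset-swap₁₂ (inj₂ (inj₂ (inj₂ (inj₁ (p , q , r)))))          = inj₂ (inj₂ (inj₂ (inj₂ (inj₂ (q , p , r)))))
SameMultiset-swap₁₂ (inj₂ (inj₂ (inj₂ (inj₂ (inj₁ (p , q , r)))))) = inj₂ (inj₁ (q , p , r))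
SameMultiset-swap₁₂ (inj₂ (inj₂ (inj₂ (inj₂ (inj₂ (p , q , r)))))) = inj₂ (inj₂ (inj₂ (inj₁ (q , p , r))))

SameMultiset-swap₂₃ : ∀ {a b c x y z} → SameMultiset a b c x y z → SameMultiset a c b x y z
SameMultiset-swap₂₃ (inj₁ (p , q , r))                               = inj₂ (inj₁ (p , r , q))
SameMultiset-swap₂₃ (inj₂ (inj₁ (p , q , r)))                        = inj₁ (p , r , q)
SameMultiset-swap₂₃ (inj₂ (inj₂ (inj₁ (p , q , r))))                 = inj₂ (inj₂ (inj₂ (inj₁ (p , r , q))))
SameMultiset-swap₂₃ (inj₂ (inj₂ (inj₂ (inj₁ (p , q , r)))))          = inj₂ (inj₂ (inj₁ (p , r , q)))
SameMultiset-swap₂₃ (inj₂ (inj₂ (inj₂ (inj₂ (inj₁ (p , q , r)))))) = inj₂ (inj₂ (inj₂ (inj₂ (inj₂ (p , r , q)))))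
SameMultiset-swap₂₃ (inj₂ (inj₂ (inj₂ (inj₂ (inj₂ (p , q , r)))))) = inj₂ (inj₂ (inj₂ (inj₂ (inj₁ (p , r , q)))))

module _ {n : ℕ} (w : Graph n) where

  wt-< : ∀ {i j} → i Fin.< j → wt w i j ≡ w i j
  wt-< {i} {j} i<j with i Finₚ.<? j
  ... | yes _   = refl
  ... | no i≮j = contradiction i<j i≮j

  wt-> : ∀ {i j} → j Fin.< i → wt w i j ≡ w j i
  wt-> {i} {j} j<i with i Finₚ.<? j
  ... | yes i<j = contradiction j<i (Finₚ.<-asym i<j)
  ... | no _    = refl

  wt-sym : ∀ {i j} → i ≢ j → wt w i j ≡ wt w j i
  wt-sym {i} {j} i≢j with Finₚ.<-cmp i j
  ... | tri< i<j _ _ = trans (wt-< i<j) (sym (wt-> i<j))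
  ... | tri≈ _ i≡j _ = contradiction i≡j i≢j
  ... | tri> _ _ j<i = trans (wt-> j<i) (sym (wt-< j<i))

  wt-lift : (Q : ℕ → Set) → (∀ i j → i Fin.< j → Q (w i j)) → ∀ {i j} → i ≢ j → Q (wt w i j)
  wt-lift Q h {i} {j} i≢j with Finₚ.<-cmp i j
  ... | tri< i<j _ _ = subst Q (sym (wt-< i<j)) (h i j i<j)
  ... | tri≈ _ i≡j _ = contradiction i≡j i≢j
  ... | tri> _ _ j<i = subst Q (sym (wt-> j<i)) (h j i j<i)

  -- The triangle a b c in any vertex order; HasTriangle only looks at increasing triples.
  Triangle : Fin n → Fin n → Fin n → ℕ → ℕ → ℕ → Set
  Triangle a b c = SameMultiset (wt w a b) (wt w a c) (wt w b c)

  private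
    swap₁₂ : ∀ {a b} c {x y z} → a ≢ b → Triangle a b c x y z → Triangle b a c x y z
    swap₁₂ _ a≢b t rewrite wt-sym (a≢b ∘ sym) = SameMultiset-swap₂₃ t

    swap₂₃ : ∀ a {b c x y z} → b ≢ c → Triangle a b c x y z → Triangle a c b x y z
    swap₂₃ _ b≢c t rewrite wt-sym (b≢c ∘ sym) = SameMultiset-swap₁₂ t

    sorted : ∀ {a b c x y z} → a Fin.< b → b Fin.< c → Triangle a b c x y z → HasTriangle w x y z
    sorted {a} {b} {c} a<b b<c t
      rewrite wt-< a<b | wt-< b<c | wt-< (Finₚ.<-trans a<b b<c) = a , b , c , a<b , b<c , t

  Triangle⇒HasTriangle : ∀ {a b c x y z} → a ≢ b → b ≢ c → a ≢ c →
    Triangle a b c x y z → HasTriangle w x y z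
  Triangle⇒HasTriangle {a} {b} {c} ab bc ac t
    with Finₚ.<-cmp a b | Finₚ.<-cmp b c | Finₚ.<-cmp a c
  ... | tri≈ _ e _ | _          | _          = contradiction e ab
  ... | _          | tri≈ _ e _ | _          = contradiction e bc
  ... | _          | _          | tri≈ _ e _ = contradiction e ac
  ... | tri< a<b _ _ | tri< b<c _ _ | _            = sorted a<b b<c t
  ... | tri< _ _ _   | tri> _ _ c<b | tri< a<c _ _ = sorted a<c c<b (swap₂₃ a bc t)
  ... | tri< a<b _ _ | tri> _ _ _   | tri> _ _ c<a = sorted c<a a<b (swap₁₂ b ac (swap₂₃ a bc t))
  ... | tri> _ _ b<a | tri< _ _ _   | tri< a<c _ _ = sorted b<a a<c (swap₁₂ c ab t)
  ... | tri> _ _ _   | tri< b<c _ _ | tri> _ _ c<a = sorted b<c c<a (swap₂₃ b ac (swap₁₂ c ab t))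
  ... | tri> _ _ b<a | tri> _ _ c<b | _            = sorted c<b b<a (swap₁₂ a bc (swap₂₃ b ac (swap₁₂ c ab t)))

module _ {n : ℕ} (w : Graph n) where

  deg : ℕ → (Fin n → Bool) → Fin n → ℕ
  deg k S x = count (λ y → S y ∧ (not (x =ᶠ y) ∧ (wt w x y =ℕ k)))

  degSum : ℕ → (Fin n → Bool) → ℕ
  degSum k S = ∑∈ S (deg k S)

  deg-remove : ∀ k S {x y} → S x ≡ true → x ≢ y → deg k S y ≡ bit (wt w x y =ℕ k) + deg k (remove x S) y
  deg-remove k S {x} {y} Sx x≢y = begin
    deg k S y
      ≡⟨ count-remove x _ ⟩
    bit (S x ∧ (not (y =ᶠ x) ∧ (wt w y x =ℕ k))) + count (λ z → (S z ∧ (not (y =ᶠ z) ∧ (wt w y z =ℕ k))) ∧ not (x =ᶠ z))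
      ≡⟨ cong₂ _+_ (cong bit x-term) (count-cong (λ z → ∧-exchange (S z) _ (not (x =ᶠ z)))) ⟩
    bit (wt w x y =ℕ k) + deg k (remove x S) y ∎
    where
    open ≡-Reasoning
    x-term : S x ∧ (not (y =ᶠ x) ∧ (wt w y x =ℕ k)) ≡ (wt w x y =ℕ k)
    x-term rewrite Sx | dec-false (y Finₚ.≟ x) (x≢y ∘ sym) | wt-sym w (x≢y ∘ sym) = refl

  degSum-remove : ∀ k S {x} → S x ≡ true → degSum k S ≡ 2 * deg k S x + degSum k (remove x S)
  degSum-remove k S {x} Sx = begin
    degSum k S
      ≡⟨ ∑∈-remove x S (deg k S) Sx ⟩
    deg k S x + ∑∈ S′ (deg k S)
      ≡⟨ cong (deg k S x +_) (∑∈-cong S′ (λ y S′y → deg-remove k S Sx (x≢ y S′y))) ⟩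
    deg k S x + ∑∈ S′ (λ y → bit (wt w x y =ℕ k) + deg k S′ y)
      ≡⟨ cong (deg k S x +_) (∑∈-+ S′ _ _) ⟩
    deg k S x + (∑∈ S′ (λ y → bit (wt w x y =ℕ k)) + degSum k S′)
      ≡⟨ cong (λ u → deg k S x + (u + degSum k S′)) (trans (∑∈-indicator S′ _) (count-cong (λ z → ∧-assoc (S z) _ _))) ⟩
    deg k S x + (deg k S x + degSum k S′)
      ≡⟨ sym (+-assoc (deg k S x) _ _) ⟩
    deg k S x + deg k S x + degSum k S′
      ≡⟨ cong (λ u → deg k S x + u + degSum k S′) (sym (+-identityʳ _)) ⟩
    2 * deg k S x + degSum k S′ ∎
    where
    open ≡-Reasoning
    S′ = remove x S
    x≢ : ∀ y → S′ y ≡ true → x ≢ y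
    x≢ y S′y = does-false⇒ (x Finₚ.≟ y) (not-true⇒ (proj₂ (∧-true⇒ S′y)))

-- The classes of 1-edges in graphs of C(n)

Positive : ∀ {n} → Graph n → Set
Positive {n} w = ∀ (i j : Fin n) → i Fin.< j → 1 ≤ w i j

weight-cases : ∀ v → 1 ≤ v → v ≤ 3 → v ≡ 1 ⊎ v ≡ 2 ⊎ v ≡ 3
weight-cases 1 _ _ = inj₁ refl
weight-cases 2 _ _ = inj₂ (inj₁ refl)
weight-cases 3 _ _ = inj₂ (inj₂ refl)
weight-cases (suc (suc (suc (suc _)))) _ (s≤s (s≤s (s≤s ())))

one-edge-values : ∀ {p q} → p ≡ 1 ⊎ p ≡ 2 ⊎ p ≡ 3 → q ≡ 1 ⊎ q ≡ 2 ⊎ q ≡ 3 →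
  ¬ SameMultiset 1 p q 2 1 1 → ¬ SameMultiset 1 p q 3 1 1 → ¬ SameMultiset 1 p q 3 2 1 → p ≡ q
one-edge-values (inj₁ refl)        (inj₁ refl)        _    _    _    = refl
one-edge-values (inj₂ (inj₁ refl)) (inj₂ (inj₁ refl)) _    _    _    = refl
one-edge-values (inj₂ (inj₂ refl)) (inj₂ (inj₂ refl)) _    _    _    = refl
one-edge-values (inj₁ refl)        (inj₂ (inj₁ refl)) ¬211 _    _    = ⊥-elim (¬211 (from-yes (sameMultiset? 1 1 2 2 1 1)))
one-edge-values (inj₁ refl)        (inj₂ (inj₂ refl)) _    ¬311 _    = ⊥-elim (¬311 (from-yes (sameMultiset? 1 1 3 3 1 1)))
one-edge-values (inj₂ (inj₁ refl)) (inj₁ refl)        ¬211 _    _    = ⊥-elim (¬211 (from-yes (sameMultiset? 1 2 1 2 1 1)))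
one-edge-values (inj₂ (inj₁ refl)) (inj₂ (inj₂ refl)) _    _    ¬321 = ⊥-elim (¬321 (from-yes (sameMultiset? 1 2 3 3 2 1)))
one-edge-values (inj₂ (inj₂ refl)) (inj₁ refl)        _    ¬311 _    = ⊥-elim (¬311 (from-yes (sameMultiset? 1 3 1 3 1 1)))
one-edge-values (inj₂ (inj₂ refl)) (inj₂ (inj₁ refl)) _    _    ¬321 = ⊥-elim (¬321 (from-yes (sameMultiset? 1 3 2 3 2 1)))

module CGraph {n : ℕ} {w : Graph n} (inC : InC w) (pos : Positive w) where

  μ≤3 : MuLe3 w
  μ≤3 = proj₁ (proj₂ (proj₁ inC))

  wt-cases : ∀ {x y} → x ≢ y → wt w x y ≡ 1 ⊎ wt w x y ≡ 2 ⊎ wt w x y ≡ 3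
  wt-cases x≢y = weight-cases _ (wt-lift w (1 ≤_) pos x≢y) (wt-lift w (_≤ 3) μ≤3 x≢y)

  -- The three triangles excluded from C(n) are exactly those with one 1-edge
  -- and two different weights on the other edges.
  wt-1⇒same-wt : ∀ {a b c} → a ≢ b → b ≢ c → a ≢ c → wt w a b ≡ 1 → wt w a c ≡ wt w b c
  wt-1⇒same-wt {a} {b} {c} ab bc ac ab≡1 =
    one-edge-values (wt-cases ac) (wt-cases bc)
      (excluded (proj₁ (proj₂ (proj₂ inC)))) (excluded (proj₁ (proj₂ inC))) (excluded (proj₂ (proj₂ (proj₂ inC))))
    where
    excluded : ∀ {x y z} → ¬ HasTriangle w x y z → ¬ SameMultiset 1 (wt w a c) (wt w b c) x y z
    excluded none t = none (Triangle⇒HasTriangle w ab bc ac (subst (λ v → SameMultiset v _ _ _ _ _) (sym ab≡1) t))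

  data _≈_ (x y : Fin n) : Set where
    same   : x ≡ y → x ≈ y
    joined : x ≢ y → wt w x y ≡ 1 → x ≈ y

  ≈-sym : ∀ {x y} → x ≈ y → y ≈ x
  ≈-sym (same x≡y)        = same (sym x≡y)
  ≈-sym (joined x≢y xy≡1) = joined (x≢y ∘ sym) (trans (wt-sym w (x≢y ∘ sym)) xy≡1)

  ≈-trans : ∀ {x y z} → x ≈ y → y ≈ z → x ≈ z
  ≈-trans (same refl) y≈z = y≈z
  ≈-trans x≈y (same refl) = x≈y
  ≈-trans {x} {y} {z} (joined x≢y xy≡1) (joined y≢z yz≡1) with x Finₚ.≟ z
  ... | yes x≡z = same x≡z
  ... | no x≢z  = joined x≢z (trans (sym (wt-1⇒same-wt (x≢y ∘ sym) x≢z y≢z yx≡1)) yz≡1)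
    where yx≡1 = trans (wt-sym w (x≢y ∘ sym)) xy≡1

  _≈ᵇ_ : Fin n → Fin n → Bool
  x ≈ᵇ y = (x =ᶠ y) ∨ (wt w x y =ℕ 1)

  ≈ᵇ⇒≈ : ∀ {x y} → (x ≈ᵇ y) ≡ true → x ≈ y
  ≈ᵇ⇒≈ {x} {y} e with x =ᶠ y in x=y
  ... | true  = same (does-true⇒ (x Finₚ.≟ y) x=y)
  ... | false = joined (does-false⇒ (x Finₚ.≟ y) x=y) (does-true⇒ (wt w x y ≟ 1) e)

  ≈⇒≈ᵇ : ∀ {x y} → x ≈ y → (x ≈ᵇ y) ≡ true
  ≈⇒≈ᵇ {x} (same refl) rewrite =ᶠ-refl x = refl
  ≈⇒≈ᵇ {x} {y} (joined x≢y xy≡1) rewrite dec-false (x Finₚ.≟ y) x≢y | xy≡1 = refl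

  ≈ᵇ-refl : ∀ x → (x ≈ᵇ x) ≡ true
  ≈ᵇ-refl x = ≈⇒≈ᵇ {x} (same refl)

  ≈ᵇ-resp : ∀ {x z} → x ≈ z → ∀ y → (x ≈ᵇ y) ≡ (z ≈ᵇ y)
  ≈ᵇ-resp {x} {z} x≈z y with x ≈ᵇ y in xy | z ≈ᵇ y in zy
  ... | true  | true  = refl
  ... | false | false = refl
  ... | true  | false = trans (sym (≈⇒≈ᵇ (≈-trans (≈-sym x≈z) (≈ᵇ⇒≈ xy)))) zy
  ... | false | true  = trans (sym xy) (≈⇒≈ᵇ (≈-trans x≈z (≈ᵇ⇒≈ zy)))

  classSize : (Fin n → Bool) → Fin n → ℕ
  classSize S x = count (λ y → S y ∧ (x ≈ᵇ y))

  classSize-resp : ∀ S {x z} → x ≈ z → classSize S x ≡ classSize S z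
  classSize-resp S x≈z = count-cong (λ y → cong (S y ∧_) (≈ᵇ-resp x≈z y))

  classSize-remove : ∀ S {x} z → S x ≡ true → classSize S z ≡ bit (z ≈ᵇ x) + classSize (remove x S) z
  classSize-remove S {x} z Sx = trans (count-remove x _)
    (cong₂ _+_ (cong (λ b → bit (b ∧ (z ≈ᵇ x))) Sx) (count-cong (λ y → ∧-exchange (S y) (z ≈ᵇ y) (not (x =ᶠ y)))))

  classSize-remove-≤ : ∀ S x z → classSize (remove x S) z ≤ classSize S z
  classSize-remove-≤ S x z = count-mono (λ y e → sub (S y) _ _ e)
    where sub : ∀ a b c → (a ∧ b) ∧ c ≡ true → a ∧ c ≡ true
          sub true true true _ = refl

  classSize≡1+deg₁ : ∀ S {x} → S x ≡ true → classSize S x ≡ suc (deg w 1 S x)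
  classSize≡1+deg₁ S {x} Sx = trans (count-remove x _) (cong₂ _+_ self (count-cong others))
    where
    self : bit (S x ∧ (x ≈ᵇ x)) ≡ 1
    self rewrite Sx | ≈ᵇ-refl x = refl
    others : ∀ y → (S y ∧ (x ≈ᵇ y)) ∧ not (x =ᶠ y) ≡ S y ∧ (not (x =ᶠ y) ∧ (wt w x y =ℕ 1))
    others y with x =ᶠ y
    ... | true  = trans (∧-zeroʳ _) (sym (∧-zeroʳ (S y)))
    ... | false = ∧-identityʳ _

  classSize≥1 : ∀ S {x} → S x ≡ true → 1 ≤ classSize S x
  classSize≥1 S Sx = subst (1 ≤_) (sym (classSize≡1+deg₁ S Sx)) (s≤s z≤n)

  deg₃+classSize≤count : ∀ S x → deg w 3 S x + classSize S x ≤ count S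
  deg₃+classSize≤count S x = count-disjoint-∪ _ _ S (λ y → proj₁ ∘ ∧-true⇒) (λ y → proj₁ ∘ ∧-true⇒) disjoint
    where
    disjoint : ∀ y → S y ∧ (not (x =ᶠ y) ∧ (wt w x y =ℕ 3)) ≡ true → S y ∧ (x ≈ᵇ y) ≡ false
    disjoint y e with ∧-true⇒ (proj₂ (∧-true⇒ {S y} e))
    ... | x≠y , xy=3 = trans (cong (S y ∧_) not-joined) (∧-zeroʳ (S y))
      where
      not-joined : (x ≈ᵇ y) ≡ false
      not-joined = cong₂ _∨_ (not-true⇒ x≠y)
        (dec-false (wt w x y ≟ 1) λ xy≡1 → contradiction (trans (sym (does-true⇒ (wt w x y ≟ 3) xy=3)) xy≡1) λ ())

  remove-other : ∀ S {x z} → S x ≡ true → S z ≡ true → (z ≈ᵇ x) ≡ false →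
    remove x S z ≡ true × classSize (remove x S) z ≡ classSize S z
  remove-other S {x} {z} Sx Sz z≉x =
    cong₂ (λ a b → a ∧ not b) Sz x≠z ,
    sym (trans (classSize-remove S z Sx) (cong (λ b → bit b + classSize (remove x S) z) z≉x))
    where x≠z = dec-false (x Finₚ.≟ z) λ x≡z → contradiction (trans (sym (≈⇒≈ᵇ (same (sym x≡z)))) z≉x) λ ()

  sibling : ∀ S {x} → S x ≡ true → 1 < classSize S x →
    ∃ λ y → remove x S y ≡ true × suc (classSize (remove x S) y) ≡ classSize S x
  sibling S {x} Sx 1<|x| with count-<⇒∃ (λ y → S y ∧ (x ≈ᵇ y)) (x =ᶠ_) (subst (_< classSize S x) (sym (count-singleton x)) 1<|x|)
  ... | y , Sy∧x≈ᵇy , x≠y = y , cong₂ (λ a b → a ∧ not b) Sy x≠y , |y|≡|x|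
    where
    open ≡-Reasoning
    Sy = proj₁ (∧-true⇒ Sy∧x≈ᵇy)
    x≈y = ≈ᵇ⇒≈ (proj₂ (∧-true⇒ Sy∧x≈ᵇy))
    |y|≡|x| = begin
      suc (classSize (remove x S) y)          ≡⟨ cong (λ b → bit b + classSize (remove x S) y) (sym (≈⇒≈ᵇ (≈-sym x≈y))) ⟩
      bit (y ≈ᵇ x) + classSize (remove x S) y ≡⟨ sym (classSize-remove S y Sx) ⟩
      classSize S y                           ≡⟨ sym (classSize-resp S x≈y) ⟩
      classSize S x                           ∎

  classes≤0⇒empty : ∀ S → (∀ y → S y ≡ true → classSize S y ≤ 0) → ∀ y → S y ≡ false
  classes≤0⇒empty S ≤0 y with S y in Sy
  ... | false = refl
  ... | true  = contradiction (≤-trans (classSize≥1 S Sy) (≤0 y Sy)) λ ()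

-- Walks along 3-edges

NoInducedCt32 : ∀ {n} → Graph n → Set
NoInducedCt32 {n} w = ¬ (Σ ℕ λ t → 3 ≤ t × Σ (Fin t → Fin n) λ f → InducedCt32 w t f)

CycleAdjacent : ℕ → ℕ → ℕ → Set
CycleAdjacent t k l = l ≡ suc k ⊎ (k ≡ 0 × suc l ≡ t)

Consec⇒CycleAdjacent : ∀ {t} (a b : Fin t) → toℕ a < toℕ b → Consec t a b → CycleAdjacent t (toℕ a) (toℕ b)
Consec⇒CycleAdjacent a b _   (inj₁ (inj₁ e))        = inj₁ (sym e)
Consec⇒CycleAdjacent a b a<b (inj₁ (inj₂ (_ , b≡0))) = contradiction (subst (toℕ a <_) b≡0 a<b) λ ()
Consec⇒CycleAdjacent a b a<b (inj₂ (inj₁ e))        = contradiction (subst (toℕ b <_) e (n<1+n _)) (<-asym a<b)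
Consec⇒CycleAdjacent a b _   (inj₂ (inj₂ (e , a≡0))) = inj₂ (a≡0 , e)

CycleAdjacent⇒Consec : ∀ {t} (a b : Fin t) → CycleAdjacent t (toℕ a) (toℕ b) → Consec t a b
CycleAdjacent⇒Consec a b (inj₁ e)         = inj₁ (inj₁ (sym e))
CycleAdjacent⇒Consec a b (inj₂ (a≡0 , e)) = inj₂ (inj₂ (e , a≡0))

Consec-sym : ∀ {t} {a b : Fin t} → Consec t a b → Consec t b a
Consec-sym (inj₁ next) = inj₂ next
Consec-sym (inj₂ next) = inj₁ next

module _ {n : ℕ} (w : Graph n) where

  InducedCycleSeq : ℕ → (ℕ → Fin n) → Set
  InducedCycleSeq t g = ∀ k l → k < l → l < t →
    g k ≢ g l × (CycleAdjacent t k l → wt w (g k) (g l) ≡ 3) × (¬ CycleAdjacent t k l → wt w (g k) (g l) ≡ 2)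

  InducedCycleSeq⇒InducedCt32 : ∀ t g → InducedCycleSeq t g → InducedCt32 w t (g ∘ toℕ)
  InducedCycleSeq⇒InducedCt32 t g h = injective , weights
    where
    injective : ∀ {a b : Fin t} → g (toℕ a) ≡ g (toℕ b) → a ≡ b
    injective {a} {b} e with <-cmp (toℕ a) (toℕ b)
    ... | tri< a<b _ _ = contradiction e (proj₁ (h _ _ a<b (Finₚ.toℕ<n b)))
    ... | tri≈ _ a≡b _ = Finₚ.toℕ-injective a≡b
    ... | tri> _ _ b<a = contradiction (sym e) (proj₁ (h _ _ b<a (Finₚ.toℕ<n a)))
    weights : ∀ (a b : Fin t) → a ≢ b →
      (Consec t a b → wt w (g (toℕ a)) (g (toℕ b)) ≡ 3) × (¬ Consec t a b → wt w (g (toℕ a)) (g (toℕ b)) ≡ 2)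
    weights a b a≢b with <-cmp (toℕ a) (toℕ b)
    ... | tri< a<b _ _ = let (_ , adj , nonadj) = h _ _ a<b (Finₚ.toℕ<n b) in
      (λ c → adj (Consec⇒CycleAdjacent a b a<b c)) ,
      (λ ¬c → nonadj (¬c ∘ CycleAdjacent⇒Consec a b))
    ... | tri≈ _ a≡b _ = contradiction (Finₚ.toℕ-injective a≡b) a≢b
    ... | tri> _ _ b<a = let (gb≢ga , adj , nonadj) = h _ _ b<a (Finₚ.toℕ<n a)
                             flip = wt-sym w (gb≢ga ∘ sym) in
      (λ c → trans flip (adj (Consec⇒CycleAdjacent b a b<a (Consec-sym c)))) ,
      (λ ¬c → trans flip (nonadj (¬c ∘ Consec-sym ∘ CycleAdjacent⇒Consec b a)))

∀<-suc : ∀ {P : ℕ → Set} {N} → (∀ q → q < N → P q) → P N → ∀ q → q < suc N → P q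
∀<-suc below PN q q<1+N with m<1+n⇒m<n∨m≡n q<1+N
... | inj₁ q<N  = below q q<N
... | inj₂ refl = PN

least-witness : (P : ℕ → Set) → Decidable P → ∀ N →
  (∀ q → q < N → ¬ P q) ⊎ ∃ λ j → j < N × P j × (∀ q → q < j → ¬ P q)
least-witness P P? zero = inj₁ λ _ ()
least-witness P P? (suc N) with least-witness P P? N
... | inj₂ (j , j<N , Pj , least) = inj₂ (j , m<n⇒m<1+n j<N , Pj , least)
... | inj₁ none with P? N
...   | yes PN = inj₂ (N , n<1+n N , PN , none)
...   | no ¬PN = inj₁ (∀<-suc none ¬PN)

greatest-witness : (P : ℕ → Set) → Decidable P → ∀ N →
  (∀ q → q < N → ¬ P q) ⊎ ∃ λ j → j < N × P j × (∀ q → q < N → j < q → ¬ P q)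
greatest-witness P P? zero = inj₁ λ _ ()
greatest-witness P P? (suc N) with P? N
... | yes PN = inj₂ (N , n<1+n N , PN , λ q q<1+N N<q → contradiction (≤-pred q<1+N) (<⇒≱ N<q))
... | no ¬PN with greatest-witness P P? N
...   | inj₁ none = inj₁ (∀<-suc none ¬PN)
...   | inj₂ (j , j<N , Pj , greatest) = inj₂ (j , m<n⇒m<1+n j<N , Pj , ∀<-suc greatest (λ _ → ¬PN))

-- The first chord of the walk that is not a 2-edge closes an induced C_t(3,2).

module ThreeWalk {n : ℕ} {w : Graph n} (inC : InC w) (pos : Positive w) (noCycle : NoInducedCt32 w)
  (x : ℕ → Fin n)
  (step : ∀ k → x k ≢ x (suc k))
  (step-wt : ∀ k → wt w (x k) (x (suc k)) ≡ 3)
  (skip : ∀ k → ¬ CGraph._≈_ inC pos (x k) (x (suc (suc k))))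
  where

  open CGraph inC pos

  Chord₂ : ℕ → ℕ → Set
  Chord₂ p q = x p ≢ x q × wt w (x p) (x q) ≡ 2

  chord₂? : ∀ p q → Dec (Chord₂ p q)
  chord₂? p q = ¬? (x p Finₚ.≟ x q) ×-dec (wt w (x p) (x q) ≟ 2)

  BadPair : ℕ → ℕ → Set
  BadPair q p = 2 + p ≤ q × ¬ Chord₂ p q

  BadEnd : ℕ → Set
  BadEnd q = ∃ (BadPair q)

  badEnd? : ∀ q → Dec (BadEnd q)
  badEnd? q with least-witness (BadPair q) (λ p → (2 + p ≤? q) ×-dec ¬? (chord₂? p q)) q
  ... | inj₂ (p , _ , bad , _) = yes (p , bad)
  ... | inj₁ none = no λ (p , bad) → none p (≤-trans (n≤1+n _) (proj₁ bad)) bad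

  ¬BadEnd⇒Chord₂ : ∀ {p q} → ¬ BadEnd q → 2 + p ≤ q → Chord₂ p q
  ¬BadEnd⇒Chord₂ {p} {q} ¬bad le = decidable-stable (chord₂? p q) (λ ¬c → ¬bad (p , le , ¬c))

  -- Without a bad pair the n + 1 vertices x 0 , … , x n would be distinct.
  some-BadEnd : ¬ (∀ q → q < suc n → ¬ BadEnd q)
  some-BadEnd none with Finₚ.pigeonhole (n<1+n n) (x ∘ toℕ)
  ... | a , b , a<b , e with m≤n⇒m<n∨m≡n a<b
  ...   | inj₂ 1+a≡b = step (toℕ a) (trans e (cong x (sym 1+a≡b)))
  ...   | inj₁ 2+a≤b = proj₁ (¬BadEnd⇒Chord₂ (none (toℕ b) (Finₚ.toℕ<n b)) 2+a≤b) e

  -- A bad pair (i , j) with j least and then i greatest is impossible.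
  module Extremal {i j : ℕ} (2+i≤j : 2 + i ≤ j) (¬chord : ¬ Chord₂ i j)
    (below : ∀ p q → q < j → 2 + p ≤ q → Chord₂ p q)
    (right : ∀ p → i < p → 2 + p ≤ j → Chord₂ p j)
    where

    private
      predecessor : ∀ {a b} → 3 + a ≤ b → ∃ λ b′ → suc b′ ≡ b × 2 + a ≤ b′
      predecessor (s≤s le) = _ , refl , le

    last-step : 3 + i ≤ j → ∃ λ j′ → Chord₂ i j′ × x j′ ≢ x j × wt w (x j′) (x j) ≡ 3
    last-step 3+i≤j with predecessor 3+i≤j
    ... | j′ , 1+j′≡j , le =
      j′ , below i j′ (subst (j′ <_) 1+j′≡j (n<1+n j′)) le ,
      subst (λ q → x j′ ≢ x q) 1+j′≡j (step j′) ,
      subst (λ q → wt w (x j′) (x q) ≡ 3) 1+j′≡j (step-wt j′)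

    ends-distinct : x i ≢ x j
    ends-distinct e with m≤n⇒m<n∨m≡n 2+i≤j
    ... | inj₂ 2+i≡j = skip i (same (subst (λ q → x i ≡ x q) (sym 2+i≡j) e))
    ... | inj₁ 3+i≤j with last-step 3+i≤j
    ...   | j′ , (_ , ij′≡2) , j′≢j , j′j≡3 = contradiction (trans (sym ij′≡2) ij′≡3) λ ()
      where ij′≡3 = trans (cong (λ v → wt w v (x j′)) e) (trans (wt-sym w (j′≢j ∘ sym)) j′j≡3)

    ends-not-1 : x i ≢ x j → wt w (x i) (x j) ≢ 1
    ends-not-1 ne ij≡1 with m≤n⇒m<n∨m≡n 2+i≤j
    ... | inj₂ 2+i≡j = skip i (joined ne′ ij≡1′)
      where ne′ = subst (λ q → x i ≢ x q) (sym 2+i≡j) ne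
            ij≡1′ = subst (λ q → wt w (x i) (x q) ≡ 1) (sym 2+i≡j) ij≡1
    ... | inj₁ 3+i≤j with last-step 3+i≤j
    ...   | j′ , (ij′≢ , ij′≡2) , j′≢j , j′j≡3 = contradiction (trans (sym ij′≡2) ij′≡3) λ ()
      where ij′≡3 = trans (wt-1⇒same-wt ne (j′≢j ∘ sym) ij′≢ ij≡1) (trans (wt-sym w (j′≢j ∘ sym)) j′j≡3)

    d : ℕ
    d = j ∸ i

    i+d≡j : i + d ≡ j
    i+d≡j = m+[n∸m]≡n (≤-trans (m≤n+m i 2) 2+i≤j)

    segment : ℕ → Fin n
    segment k = x (i + k)

    shift : ∀ {k l} → 2 + k ≤ l → 2 + (i + k) ≤ i + l
    shift {k} {l} 2+k≤l = subst (_≤ i + l) (trans (+-suc i (suc k)) (cong suc (+-suc i k))) (+-monoʳ-≤ i 2+k≤l)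

    segment-chord : ∀ k l → 2 + k ≤ l → l ≤ d → ¬ (k ≡ 0 × l ≡ d) → Chord₂ (i + k) (i + l)
    segment-chord k l 2+k≤l l≤d ¬ends with m≤n⇒m<n∨m≡n l≤d
    ... | inj₁ l<d = below (i + k) (i + l) (subst (i + l <_) i+d≡j (+-monoʳ-< i l<d)) (shift 2+k≤l)
    ... | inj₂ l≡d = subst (Chord₂ (i + k)) (sym i+l≡j) (right (i + k) i<i+k (subst (2 + (i + k) ≤_) i+l≡j (shift 2+k≤l)))
      where i+l≡j = trans (cong (i +_) l≡d) i+d≡j
            i<i+k = subst (_≤ i + k) (+-comm i 1) (+-monoʳ-≤ i (n≢0⇒n>0 (λ k≡0 → ¬ends (k≡0 , l≡d))))

    segment-cycle : x i ≢ x j → wt w (x i) (x j) ≡ 3 → InducedCycleSeq w (suc d) segment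
    segment-cycle ne ij≡3 k l k<l l<1+d with l ≟ suc k
    ... | yes refl = step′ , (λ _ → wt′) , (λ ¬adj → contradiction (inj₁ refl) ¬adj)
      where step′ = λ e → step (i + k) (trans e (cong x (+-suc i k)))
            wt′ = trans (cong (λ v → wt w (x (i + k)) (x v)) (+-suc i k)) (step-wt (i + k))
    ... | no l≢1+k with (k ≟ 0) ×-dec (l ≟ d)
    ...   | yes (k≡0 , l≡d) = subst₂ (λ a b → x a ≢ x b) i+k≡i i+l≡j ne ,
                             (λ _ → subst₂ (λ a b → wt w (x a) (x b) ≡ 3) i+k≡i i+l≡j ij≡3) ,
                             (λ ¬adj → contradiction (inj₂ (k≡0 , cong suc l≡d)) ¬adj)
      where i+k≡i = sym (trans (cong (i +_) k≡0) (+-identityʳ i))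
            i+l≡j = sym (trans (cong (i +_) l≡d) i+d≡j)
    ...   | no ¬ends = proj₁ c , (λ adj → contradiction adj ¬adj) , (λ _ → proj₂ c)
      where c = segment-chord k l (≤∧≢⇒< k<l (l≢1+k ∘ sym)) (≤-pred l<1+d) ¬ends
            ¬adj : ¬ CycleAdjacent (suc d) k l
            ¬adj (inj₁ l≡1+k)           = l≢1+k l≡1+k
            ¬adj (inj₂ (k≡0 , 1+l≡1+d)) = ¬ends (k≡0 , suc-injective 1+l≡1+d)

    ends-not-3 : x i ≢ x j → wt w (x i) (x j) ≢ 3
    ends-not-3 ne ij≡3 = noCycle (suc d , s≤s 2≤d , _ , InducedCycleSeq⇒InducedCt32 w (suc d) segment (segment-cycle ne ij≡3))
      where 2≤d = +-cancelˡ-≤ i 2 d (subst₂ _≤_ (+-comm 2 i) (sym i+d≡j) 2+i≤j)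

    impossible : ⊥
    impossible with x i Finₚ.≟ x j
    ... | yes e = ends-distinct e
    ... | no ne with wt-cases ne
    ...   | inj₁ ij≡1        = ends-not-1 ne ij≡1
    ...   | inj₂ (inj₁ ij≡2) = ¬chord (ne , ij≡2)
    ...   | inj₂ (inj₂ ij≡3) = ends-not-3 ne ij≡3

  impossible : ⊥
  impossible with least-witness BadEnd badEnd? (suc n)
  ... | inj₁ none = some-BadEnd none
  ... | inj₂ (j , _ , (p , badP) , least) with greatest-witness (BadPair j) (λ p → (2 + p ≤? j) ×-dec ¬? (chord₂? p j)) j
  ...   | inj₁ none = none p (≤-trans (n≤1+n _) (proj₁ badP)) badP
  ...   | inj₂ (i , _ , (2+i≤j , ¬chord) , greatest) = Extremal.impossible 2+i≤j ¬chord below right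
    where
    below : ∀ p q → q < j → 2 + p ≤ q → Chord₂ p q
    below p q q<j = ¬BadEnd⇒Chord₂ (least q q<j)
    right : ∀ p → i < p → 2 + p ≤ j → Chord₂ p j
    right p i<p 2+p≤j = decidable-stable (chord₂? p j) λ ¬c → greatest p (≤-trans (n≤1+n _) 2+p≤j) i<p (2+p≤j , ¬c)

module LowDegree {n : ℕ} {w : Graph n} (inC : InC w) (pos : Positive w) (noCycle : NoInducedCt32 w)
  (S : Fin n → Bool) (m : ℕ) (classes≤m : ∀ x → S x ≡ true → CGraph.classSize inC pos S x ≤ m)
  where

  open CGraph inC pos

  Escape : Fin n → Fin n → Set
  Escape p c = Σ (Fin n) λ y → S y ≡ true × c ≢ y × wt w c y ≡ 3 × ¬ (p ≈ y)

  module _ (allHigh : ∀ x → S x ≡ true → m < deg w 3 S x) where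

    -- c has more 3-neighbours in S than the class of p has members.
    escape : ∀ {p c} → S p ≡ true → S c ≡ true → Escape p c
    escape {p} {c} Sp Sc with count-<⇒∃ _ (λ y → S y ∧ (p ≈ᵇ y)) (≤-<-trans (classes≤m p Sp) (allHigh c Sc))
    ... | y , S′y , ¬py with ∧-true⇒ S′y
    ...   | Sy , rest with ∧-true⇒ rest
    ...     | c≠y , cy≡3 =
      y , Sy , does-false⇒ (c Finₚ.≟ y) (not-true⇒ c≠y) , does-true⇒ (wt w c y ≟ 3) cy≡3 ,
      λ p≈y → contradiction (trans (sym (≈⇒≈ᵇ p≈y)) (subst (λ b → b ∧ (p ≈ᵇ y) ≡ false) Sy ¬py)) λ ()

    Position : Set
    Position = Σ (Fin n × Fin n) λ (p , c) → S p ≡ true × S c ≡ true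

    escapeFrom : (s : Position) → Escape (proj₁ (proj₁ s)) (proj₂ (proj₁ s))
    escapeFrom s = escape (proj₁ (proj₂ s)) (proj₂ (proj₂ s))

    advance : Position → Position
    advance s = (proj₂ (proj₁ s) , proj₁ (escapeFrom s)) , proj₂ (proj₂ s) , proj₁ (proj₂ (escapeFrom s))

    no-vertex-of-S : ∀ v → S v ≡ true → ⊥
    no-vertex-of-S v Sv = ThreeWalk.impossible inC pos noCycle x step step-wt skip
      where
      positions : ℕ → Position
      positions zero    = (v , v) , Sv , Sv
      positions (suc k) = advance (positions k)
      x : ℕ → Fin n
      x k = proj₂ (proj₁ (positions k))
      step : ∀ k → x k ≢ x (suc k)
      step k = proj₁ (proj₂ (proj₂ (escapeFrom (positions k))))
      step-wt : ∀ k → wt w (x k) (x (suc k)) ≡ 3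
      step-wt k = proj₁ (proj₂ (proj₂ (proj₂ (escapeFrom (positions k)))))
      skip : ∀ k → ¬ (x k ≈ x (suc (suc k)))
      skip k = proj₂ (proj₂ (proj₂ (proj₂ (escapeFrom (positions (suc k))))))

  low-degree-vertex : ∀ v → S v ≡ true → ∃ λ x → S x ≡ true × deg w 3 S x ≤ m
  low-degree-vertex v Sv with Finₚ.any? (λ x → (S x Bool.≟ true) ×-dec (deg w 3 S x ≤? m))
  ... | yes found = found
  ... | no none = ⊥-elim (no-vertex-of-S (λ x Sx → ≰⇒> (λ le → none (x , Sx , le))) v Sv)

-- The edge bound

-- With T₃ , T₁ twice the numbers of 3- and 1-edges on k vertices, Bound says
-- e₃ ≤ m (k − m) and e₁ ≥ m (m − 1) / 2.
Bound : ℕ → ℕ → ℕ → ℕ → Set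
Bound T₃ T₁ m k = T₃ + 2 * (m * m) ≤ 2 * (m * k) × m * m ≤ T₁ + m

Bound-keep : ∀ {D₃ D₁ T₃ T₁ m k} → D₃ ≤ m → Bound T₃ T₁ m k → Bound (2 * D₃ + T₃) (2 * D₁ + T₁) m (suc k)
Bound-keep {D₃} {D₁} {T₃} {T₁} {m} {k} D₃≤m (b₃ , b₁) = three , ≤-trans b₁ (+-monoˡ-≤ m (m≤n+m T₁ (2 * D₁)))
  where
  open ≤-Reasoning
  three = begin
    (2 * D₃ + T₃) + 2 * (m * m) ≡⟨ +-assoc (2 * D₃) T₃ _ ⟩
    2 * D₃ + (T₃ + 2 * (m * m)) ≤⟨ +-mono-≤ (*-monoʳ-≤ 2 D₃≤m) b₃ ⟩
    2 * m + 2 * (m * k)         ≡⟨ solve 2 (λ m k → con 2 :* m :+ con 2 :* (m :* k) := con 2 :* (m :* (con 1 :+ k))) refl m k ⟩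
    2 * (m * suc k)             ∎

Bound-shrink : ∀ {D₃ T₃ T₁ m k} → D₃ + suc m ≤ suc k → Bound T₃ T₁ m k → Bound (2 * D₃ + T₃) (2 * m + T₁) (suc m) (suc k)
Bound-shrink {D₃} {T₃} {T₁} {m} {k} room (b₃ , b₁) = three , one
  where
  open ≤-Reasoning
  three = begin
    (2 * D₃ + T₃) + 2 * (suc m * suc m)
      ≡⟨ solve 3 (λ D T m → (con 2 :* D :+ T) :+ con 2 :* ((con 1 :+ m) :* (con 1 :+ m))
                         := (con 2 :* (D :+ (con 1 :+ m)) :+ con 2 :* m) :+ (T :+ con 2 :* (m :* m))) refl D₃ T₃ m ⟩
    (2 * (D₃ + suc m) + 2 * m) + (T₃ + 2 * (m * m))
      ≤⟨ +-mono-≤ (+-monoˡ-≤ (2 * m) (*-monoʳ-≤ 2 room)) b₃ ⟩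
    (2 * suc k + 2 * m) + 2 * (m * k)
      ≡⟨ solve 2 (λ m k → (con 2 :* (con 1 :+ k) :+ con 2 :* m) :+ con 2 :* (m :* k) := con 2 :* ((con 1 :+ m) :* (con 1 :+ k))) refl m k ⟩
    2 * (suc m * suc k) ∎
  one = begin
    suc m * suc m          ≡⟨ solve 1 (λ m → (con 1 :+ m) :* (con 1 :+ m) := (con 1 :+ m) :+ m :+ m :* m) refl m ⟩
    suc m + m + m * m      ≤⟨ +-monoʳ-≤ (suc m + m) b₁ ⟩
    suc m + m + (T₁ + m)   ≡⟨ solve 2 (λ T m → (con 1 :+ m) :+ m :+ (T :+ m) := (con 2 :* m :+ T) :+ (con 1 :+ m)) refl T₁ m ⟩
    (2 * m + T₁) + suc m   ∎

half-mono : ∀ {a b} → a + a ≤ b + b → a ≤ b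
half-mono {a} {b} a+a≤b+b with a ≤? b
... | yes a≤b = a≤b
... | no a≰b  = contradiction a+a≤b+b (<⇒≱ (+-mono-< (≰⇒> a≰b) (≰⇒> a≰b)))

Bound⇒edges₃≤ : ∀ {e₃ T₁ m k c} → Bound (e₃ + e₃) T₁ m k → c + m * m ≡ m * k → e₃ ≤ c
Bound⇒edges₃≤ {e₃} {T₁} {m} {k} {c} (b₃ , _) c+mm≡mk = half-mono (+-cancelʳ-≤ (2 * (m * m)) _ _ (≤-trans b₃ (≤-reflexive
  (trans (cong (2 *_) (sym c+mm≡mk)) (solve 2 (λ c q → con 2 :* (c :+ q) := (c :+ c) :+ con 2 :* q) refl c (m * m))))))

Bound⇒edges₁≥ : ∀ {T₃ e₁ m k c} → Bound T₃ (e₁ + e₁) m k → c + c + m ≡ m * m → c ≤ e₁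
Bound⇒edges₁≥ {m = m} (_ , b₁) c+c+m≡mm = half-mono (+-cancelʳ-≤ m _ _ (≤-trans (≤-reflexive c+c+m≡mm) b₁))

module EdgeBound {n : ℕ} {w : Graph n} (inC : InC w) (pos : Positive w) (noCycle : NoInducedCt32 w) where

  open CGraph inC pos

  LargestClass : (Fin n → Bool) → ℕ → Set
  LargestClass S m = (∃ λ z → S z ≡ true × classSize S z ≡ m) × (∀ x → S x ≡ true → classSize S x ≤ m)

  EdgeBoundFor : ℕ → Set
  EdgeBoundFor k = ∀ S → count S ≡ k → ∀ m → LargestClass S m → Bound (degSum w 3 S) (degSum w 1 S) m k

  edge-bound-zero : EdgeBoundFor 0
  edge-bound-zero S |S|≡0 m ((z , Sz , _) , _) = contradiction (trans (sym |S|≡0) (count-remove-member S Sz)) λ ()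

  via-removal : ∀ S {x m k} → S x ≡ true →
    Bound (2 * deg w 3 S x + degSum w 3 (remove x S)) (2 * deg w 1 S x + degSum w 1 (remove x S)) m k →
    Bound (degSum w 3 S) (degSum w 1 S) m k
  via-removal S Sx = subst₂ (λ T₃ T₁ → Bound T₃ T₁ _ _) (sym (degSum-remove w 3 S Sx)) (sym (degSum-remove w 1 S Sx))

  shrunk : ∀ k → EdgeBoundFor k → ∀ S {x} → S x ≡ true → count (remove x S) ≡ k → ∀ m →
    classSize S x ≡ suc m → (∀ y → remove x S y ≡ true → classSize (remove x S) y ≤ m) →
    Bound (degSum w 3 (remove x S)) (degSum w 1 (remove x S)) m k
  shrunk k IH S Sx |S′|≡k zero _ ≤0 =
    subst (λ T → T + 0 ≤ 0) (sym (∑∈-empty _ _ (classes≤0⇒empty _ ≤0))) z≤n , z≤n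
  shrunk k IH S Sx |S′|≡k (suc m) |x|≡2+m ≤1+m with sibling S Sx (subst (1 <_) (sym |x|≡2+m) (s≤s (s≤s z≤n)))
  ... | y , S′y , 1+|y|≡|x| = IH _ |S′|≡k (suc m) ((y , S′y , suc-injective (trans 1+|y|≡|x| |x|≡2+m)) , ≤1+m)

  -- Removing x shrank the largest class, which was the class of x.
  shrink : ∀ k → EdgeBoundFor k → ∀ S {x} → S x ≡ true → count (remove x S) ≡ k →
    deg w 3 S x + suc (deg w 1 S x) ≤ suc k →
    (∀ y → remove x S y ≡ true → classSize (remove x S) y ≤ deg w 1 S x) →
    Bound (degSum w 3 S) (degSum w 1 S) (suc (deg w 1 S x)) (suc k)
  shrink k IH S Sx |S′|≡k room ≤d₁ =
    via-removal S {k = suc k} Sx (Bound-shrink room (shrunk k IH S Sx |S′|≡k _ (classSize≡1+deg₁ S Sx) ≤d₁))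

  edge-bound-suc : ∀ k → EdgeBoundFor k → EdgeBoundFor (suc k)
  edge-bound-suc k IH S |S|≡1+k m ((z , Sz , |z|≡m) , ≤m) with LowDegree.low-degree-vertex inC pos noCycle S m ≤m z Sz
  ... | x , Sx , deg₃≤m = after-removal
    where
    S′ = remove x S
    |S′|≡k : count S′ ≡ k
    |S′|≡k = suc-injective (trans (sym (count-remove-member S Sx)) |S|≡1+k)
    ≤m′ : ∀ y → S′ y ≡ true → classSize S′ y ≤ m
    ≤m′ y S′y = ≤-trans (classSize-remove-≤ S x y) (≤m y (proj₁ (∧-true⇒ S′y)))
    after-removal : Bound (degSum w 3 S) (degSum w 1 S) m (suc k)
    after-removal with Finₚ.any? (λ y → (S′ y Bool.≟ true) ×-dec (classSize S′ y ≟ m))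
    ... | yes kept = via-removal S Sx (Bound-keep {D₁ = deg w 1 S x} deg₃≤m (IH S′ |S′|≡k m (kept , ≤m′)))
    ... | no ¬kept = subst (λ c → Bound (degSum w 3 S) (degSum w 1 S) c (suc k)) 1+d₁≡m (shrink k IH S Sx |S′|≡k room ≤d₁)
      where
      z≈x : z ≈ x
      z≈x with z ≈ᵇ x in z≈ᵇx
      ... | true  = ≈ᵇ⇒≈ z≈ᵇx
      ... | false = ⊥-elim (¬kept (z , proj₁ kept , trans (proj₂ kept) |z|≡m))
        where kept = remove-other S Sx Sz z≈ᵇx
      |x|≡1+d₁ = classSize≡1+deg₁ S Sx
      1+d₁≡m : suc (deg w 1 S x) ≡ m
      1+d₁≡m = trans (sym |x|≡1+d₁) (trans (classSize-resp S (≈-sym z≈x)) |z|≡m)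
      room = subst₂ (λ c K → deg w 3 S x + c ≤ K) |x|≡1+d₁ |S|≡1+k (deg₃+classSize≤count S x)
      ≤d₁ : ∀ y → S′ y ≡ true → classSize S′ y ≤ deg w 1 S x
      ≤d₁ y S′y = ≤-pred (subst (classSize S′ y <_) (sym 1+d₁≡m) (≤∧≢⇒< (≤m′ y S′y) (λ e → ¬kept (y , S′y , e))))

  edge-bound : ∀ k → EdgeBoundFor k
  edge-bound zero    = edge-bound-zero
  edge-bound (suc k) = edge-bound-suc k (edge-bound k)

-- The product of the weights

pow23 : ℕ → ℕ → ℕ
pow23 a b = 2 ^ a * 3 ^ b

pow23-+ : ∀ a b c d → pow23 a b * pow23 c d ≡ pow23 (a + c) (b + d)
pow23-+ a b c d rewrite ^-distribˡ-+-* 2 a c | ^-distribˡ-+-* 3 b d =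
  solve 4 (λ x y z u → (x :* y) :* (z :* u) := (x :* z) :* (y :* u)) refl (2 ^ a) (3 ^ b) (2 ^ c) (3 ^ d)

-- Trading a factor 2 for a factor 3 increases the product.
pow23-mono : ∀ {a b c d} → b ≤ d → a + b ≤ c + d → pow23 a b ≤ pow23 c d
pow23-mono {a} {b} {c} {d} b≤d a+b≤c+d with m≤n⇒∃[o]m+o≡n b≤d
... | e , refl = begin
  2 ^ a * 3 ^ b       ≤⟨ *-monoˡ-≤ (3 ^ b) (^-monoʳ-≤ 2 a≤c+e) ⟩
  2 ^ (c + e) * 3 ^ b ≡⟨ cong (_* 3 ^ b) (^-distribˡ-+-* 2 c e) ⟩
  2 ^ c * 2 ^ e * 3 ^ b ≤⟨ *-monoˡ-≤ (3 ^ b) (*-monoʳ-≤ (2 ^ c) (^-monoˡ-≤ e (s≤s (s≤s z≤n)))) ⟩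
  2 ^ c * 3 ^ e * 3 ^ b ≡⟨ *-assoc (2 ^ c) (3 ^ e) (3 ^ b) ⟩
  2 ^ c * (3 ^ e * 3 ^ b) ≡⟨ cong (2 ^ c *_) (trans (sym (^-distribˡ-+-* 3 e b)) (cong (3 ^_) (+-comm e b))) ⟩
  2 ^ c * 3 ^ (b + e) ∎
  where
  open ≤-Reasoning
  a≤c+e : a ≤ c + e
  a≤c+e = +-cancelʳ-≤ b a (c + e) (subst (a + b ≤_) (solve 3 (λ b c e → c :+ (b :+ e) := (c :+ e) :+ b) refl b c e) a+b≤c+d)

weight≡pow23 : ∀ v → 1 ≤ v → v ≤ 3 → v ≡ pow23 (bit (v =ℕ 2)) (bit (v =ℕ 3))
weight≡pow23 1 _ _ = refl
weight≡pow23 2 _ _ = refl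
weight≡pow23 3 _ _ = refl
weight≡pow23 (suc (suc (suc (suc _)))) _ (s≤s (s≤s (s≤s ())))

product≡pow23 : ∀ {n} (f : Fin n → ℕ) → (∀ j → 1 ≤ f j) → (∀ j → f j ≤ 3) →
  product (tabulate f) ≡ pow23 (count (λ j → f j =ℕ 2)) (count (λ j → f j =ℕ 3))
product≡pow23 {zero}  f _  _  = refl
product≡pow23 {suc n} f 1≤ ≤3 =
  trans (cong₂ _*_ (weight≡pow23 (f fz) (1≤ fz) (≤3 fz)) (product≡pow23 (f ∘ fs) (1≤ ∘ fs) (≤3 ∘ fs)))
        (pow23-+ (bit (f fz =ℕ 2)) (bit (f fz =ℕ 3)) _ _)

row-total : ∀ {n} (f : Fin n → ℕ) → (∀ j → 1 ≤ f j) → (∀ j → f j ≤ 3) →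
  count (λ j → f j =ℕ 1) + count (λ j → f j =ℕ 2) + count (λ j → f j =ℕ 3) ≡ n
row-total {zero}  f _  _  = refl
row-total {suc n} f 1≤ ≤3 with weight-cases (f fz) (1≤ fz) (≤3 fz) | row-total (f ∘ fs) (1≤ ∘ fs) (≤3 ∘ fs)
... | inj₁ e        | rest rewrite e = cong suc rest
... | inj₂ (inj₁ e) | rest rewrite e = trans (cong (_+ count (λ j → f (fs j) =ℕ 3)) (+-suc (count (λ j → f (fs j) =ℕ 1)) _)) (cong suc rest)
... | inj₂ (inj₂ e) | rest rewrite e = trans (+-suc _ (count (λ j → f (fs j) =ℕ 3))) (cong suc rest)

dropFirst : ∀ {n} → Graph (suc n) → Graph n
dropFirst w i j = w (fs i) (fs j)

edges : ℕ → ∀ {n} → Graph n → ℕ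
edges k {zero}  w = 0
edges k {suc n} w = count (λ j → w fz (fs j) =ℕ k) + edges k (dropFirst w)

pairCount : ℕ → ℕ
pairCount zero    = 0
pairCount (suc n) = n + pairCount n

module _ {n : ℕ} {w : Graph (suc n)} where

  Positive-drop : Positive w → Positive (dropFirst w)
  Positive-drop pos i j i<j = pos (fs i) (fs j) (s≤s i<j)

  MuLe3-drop : MuLe3 w → MuLe3 (dropFirst w)
  MuLe3-drop μ≤3 i j i<j = μ≤3 (fs i) (fs j) (s≤s i<j)

P≡pow23 : ∀ {n} (w : Graph n) → Positive w → MuLe3 w → P w ≡ pow23 (edges 2 w) (edges 3 w)
P≡pow23 {zero}  w _   _   = refl
P≡pow23 {suc n} w pos μ≤3 =
  trans (cong₂ _*_ (product≡pow23 (λ j → w fz (fs j)) (λ j → pos fz (fs j) (s≤s z≤n)) (λ j → μ≤3 fz (fs j) (s≤s z≤n)))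
                   (P≡pow23 (dropFirst w) (Positive-drop pos) (MuLe3-drop μ≤3)))
        (pow23-+ (count (λ j → w fz (fs j) =ℕ 2)) (count (λ j → w fz (fs j) =ℕ 3)) _ _)

edges-total : ∀ {n} (w : Graph n) → Positive w → MuLe3 w → edges 1 w + edges 2 w + edges 3 w ≡ pairCount n
edges-total {zero}  w _   _   = refl
edges-total {suc n} w pos μ≤3 =
  trans (solve 6 (λ a b c d e f → (a :+ d) :+ (b :+ e) :+ (c :+ f) := (a :+ b :+ c) :+ (d :+ e :+ f)) refl
           (row 1) (row 2) (row 3) (edges 1 (dropFirst w)) (edges 2 (dropFirst w)) (edges 3 (dropFirst w)))
        (cong₂ _+_ (row-total (λ j → w fz (fs j)) (λ j → pos fz (fs j) (s≤s z≤n)) (λ j → μ≤3 fz (fs j) (s≤s z≤n)))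
                   (edges-total (dropFirst w) (Positive-drop pos) (MuLe3-drop μ≤3)))
  where row = λ k → count (λ j → w fz (fs j) =ℕ k)

product-positive-or-zero : ∀ {n} (f : Fin n → ℕ) → (∀ j → 1 ≤ f j) ⊎ product (tabulate f) ≡ 0
product-positive-or-zero {zero}  f = inj₁ λ ()
product-positive-or-zero {suc n} f with f fz in e | product-positive-or-zero (f ∘ fs)
... | zero  | _        = inj₂ refl
... | suc v | inj₂ rest = inj₂ (trans (cong (suc v *_) rest) (*-zeroʳ (suc v)))
... | suc v | inj₁ rest = inj₁ λ { fz → subst (1 ≤_) (sym e) (s≤s z≤n) ; (fs j) → rest j }

Positive⊎P≡0 : ∀ {n} (w : Graph n) → Positive w ⊎ P w ≡ 0
Positive⊎P≡0 {zero}  w = inj₁ λ ()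
Positive⊎P≡0 {suc n} w with product-positive-or-zero (λ j → w fz (fs j)) | Positive⊎P≡0 (dropFirst w)
... | inj₂ row≡0 | _ = inj₂ (cong (_* P (dropFirst w)) row≡0)
... | inj₁ _     | inj₂ rest≡0 = inj₂ (trans (cong (row *_) rest≡0) (*-zeroʳ row))
  where row = product (tabulate (λ j → w fz (fs j)))
... | inj₁ row   | inj₁ rest = inj₁ λ { fz (fs j) _ → row j ; (fs i) (fs j) (s≤s i<j) → rest i j i<j }

full : ∀ {n} → Fin n → Bool
full _ = true

wt-dropFirst : ∀ {n} (w : Graph (suc n)) i j → wt w (fs i) (fs j) ≡ wt (dropFirst w) i j
wt-dropFirst w i j with i Finₚ.<? j | fs i Finₚ.<? fs j
... | yes _   | yes _         = refl
... | no _    | no _          = refl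
... | yes i<j | no 1+i≮1+j    = contradiction (s≤s i<j) 1+i≮1+j
... | no i≮j  | yes (s≤s i<j) = contradiction i<j i≮j

degSum-full : ∀ {n} (w : Graph n) k → degSum w k full ≡ edges k w + edges k w
degSum-full {zero}  w k = refl
degSum-full {suc n} w k = begin
  deg w k full fz + ∑∈ full (deg w k full ∘ fs)
    ≡⟨ cong (row +_) (sum-cong-≗ dropped) ⟩
  row + sum (λ i → bit (w fz (fs i) =ℕ k) + deg (dropFirst w) k full i)
    ≡⟨ cong (row +_) (∑-distrib-+ (λ i → bit (w fz (fs i) =ℕ k)) (deg (dropFirst w) k full)) ⟩
  row + (row + degSum (dropFirst w) k full)
    ≡⟨ cong (λ u → row + (row + u)) (degSum-full (dropFirst w) k) ⟩
  row + (row + (rest + rest))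
    ≡⟨ solve 2 (λ r c → r :+ (r :+ (c :+ c)) := (r :+ c) :+ (r :+ c)) refl row rest ⟩
  (row + rest) + (row + rest) ∎
  where
  open ≡-Reasoning
  row = count (λ j → w fz (fs j) =ℕ k)
  rest = edges k (dropFirst w)
  dropped : ∀ i → deg w k full (fs i) ≡ bit (w fz (fs i) =ℕ k) + deg (dropFirst w) k full i
  dropped i = cong (bit (w fz (fs i) =ℕ k) +_) (count-cong (λ j → cong (λ v → not (i =ᶠ j) ∧ (v =ℕ k)) (wt-dropFirst w i j)))

-- The graphs of W(n)

SideWeight≤3 : ∀ a b → SideWeight a b ≤ 3
SideWeight≤3 true  true  = ≤ᵇ⇒≤ _ _ _
SideWeight≤3 true  false = ≤ᵇ⇒≤ _ _ _
SideWeight≤3 false true  = ≤ᵇ⇒≤ _ _ _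
SideWeight≤3 false false = ≤ᵇ⇒≤ _ _ _

SideWeight≥1 : ∀ a b → 1 ≤ SideWeight a b
SideWeight≥1 true  true  = s≤s z≤n
SideWeight≥1 true  false = s≤s z≤n
SideWeight≥1 false true  = s≤s z≤n
SideWeight≥1 false false = s≤s z≤n

SideWeight-sym : ∀ a b → SideWeight a b ≡ SideWeight b a
SideWeight-sym true  true  = refl
SideWeight-sym true  false = refl
SideWeight-sym false true  = refl
SideWeight-sym false false = refl

SideWeight-3 : ∀ a b c → SideWeight a b + SideWeight a c + SideWeight b c ≤ 8
SideWeight-3 true  true  true  = ≤ᵇ⇒≤ _ _ _
SideWeight-3 true  true  false = ≤ᵇ⇒≤ _ _ _
SideWeight-3 true  false true  = ≤ᵇ⇒≤ _ _ _
SideWeight-3 true  false false = ≤ᵇ⇒≤ _ _ _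
SideWeight-3 false true  true  = ≤ᵇ⇒≤ _ _ _
SideWeight-3 false true  false = ≤ᵇ⇒≤ _ _ _
SideWeight-3 false false true  = ≤ᵇ⇒≤ _ _ _
SideWeight-3 false false false = ≤ᵇ⇒≤ _ _ _

SideWeight-4 : ∀ a b c d →
  SideWeight a b + SideWeight a c + SideWeight a d + SideWeight b c + SideWeight b d + SideWeight c d ≤ 15
SideWeight-4 true  true  true  true  = ≤ᵇ⇒≤ _ _ _
SideWeight-4 true  true  true  false = ≤ᵇ⇒≤ _ _ _
SideWeight-4 true  true  false true  = ≤ᵇ⇒≤ _ _ _
SideWeight-4 true  true  false false = ≤ᵇ⇒≤ _ _ _
SideWeight-4 true  false true  true  = ≤ᵇ⇒≤ _ _ _
SideWeight-4 true  false true  false = ≤ᵇ⇒≤ _ _ _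
SideWeight-4 true  false false true  = ≤ᵇ⇒≤ _ _ _
SideWeight-4 true  false false false = ≤ᵇ⇒≤ _ _ _
SideWeight-4 false true  true  true  = ≤ᵇ⇒≤ _ _ _
SideWeight-4 false true  true  false = ≤ᵇ⇒≤ _ _ _
SideWeight-4 false true  false true  = ≤ᵇ⇒≤ _ _ _
SideWeight-4 false true  false false = ≤ᵇ⇒≤ _ _ _
SideWeight-4 false false true  true  = ≤ᵇ⇒≤ _ _ _
SideWeight-4 false false true  false = ≤ᵇ⇒≤ _ _ _
SideWeight-4 false false false true  = ≤ᵇ⇒≤ _ _ _
SideWeight-4 false false false false = ≤ᵇ⇒≤ _ _ _

SideTriangle : Bool → Bool → Bool → ℕ → ℕ → ℕ → Set
SideTriangle a b c = SameMultiset (SideWeight a b) (SideWeight a c) (SideWeight b c)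

SideTriangle-allowed : ∀ a b c →
  False (sameMultiset? (SideWeight a b) (SideWeight a c) (SideWeight b c) 3 1 1) ×
  False (sameMultiset? (SideWeight a b) (SideWeight a c) (SideWeight b c) 2 1 1) ×
  False (sameMultiset? (SideWeight a b) (SideWeight a c) (SideWeight b c) 3 2 1)
SideTriangle-allowed true  true  true  = _
SideTriangle-allowed true  true  false = _
SideTriangle-allowed true  false true  = _
SideTriangle-allowed true  false false = _
SideTriangle-allowed false true  true  = _
SideTriangle-allowed false true  false = _
SideTriangle-allowed false false true  = _
SideTriangle-allowed false false false = _

-- 3-edges join the two sides, so the sides alternate along a path of 3-edges.
no-3-triangle : ∀ a b c → SideWeight a b ≡ 3 → SideWeight b c ≡ 3 → SideWeight a c ≢ 3
no-3-triangle true  false true  _ _ ()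
no-3-triangle false true  false _ _ ()

no-3-path : ∀ a b c d → SideWeight a b ≡ 3 → SideWeight b c ≡ 3 → SideWeight c d ≡ 3 →
  SideWeight a c ≡ 2 → SideWeight b d ≢ 2
no-3-path true  false true  false _ _ _ () _
no-3-path false true  false true  _ _ _ _ ()

module _ {n : ℕ} (w : Graph n) (side : Fin n → Bool)
  (w≡ : ∀ (i j : Fin n) → i Fin.< j → w i j ≡ SideWeight (side i) (side j)) where

  wt≡SideWeight : ∀ {i j} → i ≢ j → wt w i j ≡ SideWeight (side i) (side j)
  wt≡SideWeight {i} {j} i≢j with Finₚ.<-cmp i j
  ... | tri< i<j _ _ = trans (wt-< w i<j) (w≡ i j i<j)
  ... | tri≈ _ i≡j _ = contradiction i≡j i≢j
  ... | tri> _ _ j<i = trans (wt-> w j<i) (trans (w≡ j i j<i) (SideWeight-sym _ _))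

  W-no-triangle : ∀ {x y z} → (∀ a b c → ¬ SideTriangle a b c x y z) → ¬ HasTriangle w x y z
  W-no-triangle none (i , j , k , i<j , j<k , t)
    rewrite w≡ i j i<j | w≡ i k (Finₚ.<-trans i<j j<k) | w≡ j k j<k = none _ _ _ t

  W-no-cycle : NoInducedCt32 w
  W-no-cycle (1 , s≤s () , _)
  W-no-cycle (2 , s≤s (s≤s ()) , _)
  W-no-cycle (suc (suc (suc t)) , _ , f , f-inj , weights) = cases t refl
    where
    sw : ∀ (a b : Fin (3 + t)) → a ≢ b → wt w (f a) (f b) ≡ SideWeight (side (f a)) (side (f b))
    sw a b a≢b = wt≡SideWeight (a≢b ∘ f-inj)
    0-1 : SideWeight (side (f fz)) (side (f (fs fz))) ≡ 3
    0-1 = trans (sym (sw _ _ λ ())) (proj₁ (weights _ _ λ ()) (inj₁ (inj₁ refl)))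
    1-2 : SideWeight (side (f (fs fz))) (side (f (fs (fs fz)))) ≡ 3
    1-2 = trans (sym (sw _ _ λ ())) (proj₁ (weights _ _ λ ()) (inj₁ (inj₁ refl)))
    cases : ∀ u → u ≡ t → ⊥
    cases zero refl = no-3-triangle _ _ _ 0-1 1-2
      (trans (sym (sw _ _ λ ())) (proj₁ (weights fz (fs (fs fz)) λ ()) (inj₂ (inj₂ (refl , refl)))))
    cases (suc u) refl = no-3-path _ _ _ _ 0-1 1-2 2-3 0-2 1-3
      where
      2-3 = trans (sym (sw _ _ λ ())) (proj₁ (weights (fs (fs fz)) (fs (fs (fs fz))) λ ()) (inj₁ (inj₁ refl)))
      0-2 = trans (sym (sw _ _ λ ())) (proj₂ (weights fz (fs (fs fz)) λ ())
        λ { (inj₁ (inj₁ ())) ; (inj₁ (inj₂ (() , _))) ; (inj₂ (inj₁ ())) ; (inj₂ (inj₂ (() , _))) })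
      1-3 = trans (sym (sw _ _ λ ())) (proj₂ (weights (fs fz) (fs (fs (fs fz))) λ ())
        λ { (inj₁ (inj₁ ())) ; (inj₁ (inj₂ (_ , ()))) ; (inj₂ (inj₁ ())) ; (inj₂ (inj₂ (_ , ()))) })

  W⊆NC : InNC w
  W⊆NC = ((is415 , μ≤3 , is38) ,
          W-no-triangle (λ a b c → toWitnessFalse (proj₁ (SideTriangle-allowed a b c))) ,
          W-no-triangle (λ a b c → toWitnessFalse (proj₁ (proj₂ (SideTriangle-allowed a b c)))) ,
          W-no-triangle (λ a b c → toWitnessFalse (proj₂ (proj₂ (SideTriangle-allowed a b c))))) ,
         W-no-cycle
    where
    μ≤3 : MuLe3 w
    μ≤3 i j i<j rewrite w≡ i j i<j = SideWeight≤3 _ _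
    is38 : Is38 w
    is38 i j k i<j j<k rewrite w≡ i j i<j | w≡ i k (Finₚ.<-trans i<j j<k) | w≡ j k j<k = SideWeight-3 (side i) (side j) (side k)
    is415 : Is415 w
    is415 i j k l i<j j<k k<l
      rewrite w≡ i j i<j | w≡ i k (Finₚ.<-trans i<j j<k) | w≡ i l (Finₚ.<-trans i<j (Finₚ.<-trans j<k k<l))
            | w≡ j k j<k | w≡ j l (Finₚ.<-trans j<k k<l) | w≡ k l k<l = SideWeight-4 (side i) (side j) (side k) (side l)

InW⇒InNC : ∀ {n} {w : Graph n} → InW w → InNC w
InW⇒InNC {w = w} (side , w≡) = W⊆NC w side w≡

split : ∀ n → ℕ → Graph n
split n a i j = SideWeight (toℕ i <ᵇ a) (toℕ j <ᵇ a)

split∈W : ∀ n a → InW (split n a)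
split∈W n a = (λ i → toℕ i <ᵇ a) , λ _ _ _ → refl

Positive-split : ∀ n a → Positive (split n a)
Positive-split n a _ _ _ = SideWeight≥1 _ _

MuLe3-split : ∀ n a → MuLe3 (split n a)
MuLe3-split n a _ _ _ = SideWeight≤3 _ _

count-first : ∀ {n} a → a ≤ n → count (λ (j : Fin n) → toℕ j <ᵇ a) ≡ a
count-first {zero}  zero    _       = refl
count-first {suc n} zero    _       = count-empty (λ (j : Fin (suc n)) → toℕ j <ᵇ 0) λ _ → refl
count-first {suc n} (suc a) (s≤s a≤n) = cong suc (count-first a a≤n)

count-not : ∀ {n} (S : Fin n → Bool) → count (not ∘ S) + count S ≡ n
count-not {zero}  S = refl
count-not {suc n} S with S fz
... | true  = trans (+-suc _ _) (cong suc (count-not (S ∘ fs)))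
... | false = cong suc (count-not (S ∘ fs))

split-edges₃ : ∀ n a → a ≤ n → edges 3 (split n a) + a * a ≡ a * n
split-edges₃ zero    zero    _ = refl
split-edges₃ (suc n) zero    _ =
  trans (cong (λ r → r + edges 3 (split n 0) + 0) (count-empty (λ j → split (suc n) 0 fz (fs j) =ℕ 3) λ _ → refl))
        (split-edges₃ n zero z≤n)
split-edges₃ (suc n) (suc a) (s≤s a≤n) = begin
  (row + edges 3 (split n a)) + suc a * suc a
    ≡⟨ solve 3 (λ r c a → (r :+ c) :+ (con 1 :+ a) :* (con 1 :+ a) := (r :+ a) :+ (c :+ a :* a) :+ (con 1 :+ a)) refl row (edges 3 (split n a)) a ⟩
  (row + a) + (edges 3 (split n a) + a * a) + suc a
    ≡⟨ cong₂ (λ u v → u + v + suc a) row+a≡n (split-edges₃ n a a≤n) ⟩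
  n + a * n + suc a
    ≡⟨ solve 2 (λ n a → n :+ a :* n :+ (con 1 :+ a) := (con 1 :+ a) :* (con 1 :+ n)) refl n a ⟩
  suc a * suc n ∎
  where
  open ≡-Reasoning
  row = count (λ (j : Fin n) → SideWeight true (toℕ j <ᵇ a) =ℕ 3)
  row≡ : ∀ b → (SideWeight true b =ℕ 3) ≡ not b
  row≡ true  = refl
  row≡ false = refl
  row+a≡n : row + a ≡ n
  row+a≡n = trans (cong₂ _+_ (count-cong {T = λ (j : Fin n) → not (toℕ j <ᵇ a)} (λ j → row≡ (toℕ j <ᵇ a)))
                              (sym (count-first a a≤n)))
                  (count-not (λ (j : Fin n) → toℕ j <ᵇ a))

split-edges₁ : ∀ n a → a ≤ n → edges 1 (split n a) + edges 1 (split n a) + a ≡ a * a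
split-edges₁ zero    zero    _ = refl
split-edges₁ (suc n) zero    _ =
  trans (cong (λ u → u + u + 0)
           (cong (_+ edges 1 (split n 0)) (count-empty (λ j → split (suc n) 0 fz (fs j) =ℕ 1) λ _ → refl)))
        (split-edges₁ n zero z≤n)
split-edges₁ (suc n) (suc a) (s≤s a≤n) = begin
  (row + rest) + (row + rest) + suc a
    ≡⟨ cong (λ u → (u + rest) + (u + rest) + suc a) row≡a ⟩
  (a + rest) + (a + rest) + suc a
    ≡⟨ solve 2 (λ a c → (a :+ c) :+ (a :+ c) :+ (con 1 :+ a) := (c :+ c :+ a) :+ (con 1 :+ a :+ a)) refl a rest ⟩
  (rest + rest + a) + (suc a + a)
    ≡⟨ cong (_+ (suc a + a)) (split-edges₁ n a a≤n) ⟩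
  a * a + (suc a + a)
    ≡⟨ solve 1 (λ a → a :* a :+ ((con 1 :+ a) :+ a) := (con 1 :+ a) :* (con 1 :+ a)) refl a ⟩
  suc a * suc a ∎
  where
  open ≡-Reasoning
  rest = edges 1 (split n a)
  row = count (λ (j : Fin n) → SideWeight true (toℕ j <ᵇ a) =ℕ 1)
  row≡ : ∀ b → (SideWeight true b =ℕ 1) ≡ b
  row≡ true  = refl
  row≡ false = refl
  row≡a : row ≡ a
  row≡a = trans (count-cong {T = λ (j : Fin n) → toℕ j <ᵇ a} (λ j → row≡ (toℕ j <ᵇ a))) (count-first a a≤n)

P-mono-edges : ∀ {n} (G H : Graph n) → Positive G → MuLe3 G → Positive H → MuLe3 H →
  edges 3 G ≤ edges 3 H → edges 1 H ≤ edges 1 G → P G ≤ P H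
P-mono-edges G H posG μG posH μH e₃≤ e₁≥ =
  subst₂ _≤_ (sym (P≡pow23 G posG μG)) (sym (P≡pow23 H posH μH)) (pow23-mono e₃≤ e₂₃≤)
  where
  e₂₃≤ : edges 2 G + edges 3 G ≤ edges 2 H + edges 3 H
  e₂₃≤ = +-cancelˡ-≤ (edges 1 H) _ _ (≤-trans (+-monoˡ-≤ _ e₁≥)
           (≤-reflexive (trans (sym (+-assoc (edges 1 G) _ _))
              (trans (trans (edges-total G posG μG) (sym (edges-total H posH μH))) (+-assoc (edges 1 H) _ _)))))

argmax : ∀ {n} (f : Fin (suc n) → ℕ) → ∃ λ z → ∀ x → f x ≤ f z
argmax {zero}  f = fz , λ { fz → ≤-refl }
argmax {suc n} f with argmax (f ∘ fs)
... | z , max with f fz ≤? f (fs z)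
...   | yes f0≤ = fs z , λ { fz → f0≤ ; (fs x) → max x }
...   | no f0≰  = fz , λ { fz → ≤-refl ; (fs x) → ≤-trans (max x) (<⇒≤ (≰⇒> f0≰)) }

count-full : ∀ {n} → count (full {n}) ≡ n
count-full {zero}  = refl
count-full {suc n} = cong suc (count-full {n})

-- m is the size of a largest class; the edge bound compares H with the split graph with |L| = m.
NC-below-split : ∀ {n} (H : Graph (suc n)) → InNC H → ∃ λ m → m ≤ suc n × P H ≤ P (split (suc n) m)
NC-below-split {n} H (inC , noCycle) with Positive⊎P≡0 H
... | inj₂ P≡0 = 0 , z≤n , subst (_≤ P (split (suc n) 0)) (sym P≡0) z≤n
... | inj₁ pos = m , m≤1+n ,
  P-mono-edges H W pos (CGraph.μ≤3 inC pos) (Positive-split (suc n) m) (MuLe3-split (suc n) m)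
    (Bound⇒edges₃≤ {T₁ = edges 1 H + edges 1 H} bound (split-edges₃ (suc n) m m≤1+n))
    (Bound⇒edges₁≥ {T₃ = edges 3 H + edges 3 H} bound (split-edges₁ (suc n) m m≤1+n))
  where
  open CGraph inC pos using (classSize; _≈ᵇ_)
  largest = argmax (classSize full)
  m = classSize full (proj₁ largest)
  W = split (suc n) m
  m≤1+n : m ≤ suc n
  m≤1+n = count-≤ (λ y → true ∧ (proj₁ largest ≈ᵇ y))
  bound : Bound (edges 3 H + edges 3 H) (edges 1 H + edges 1 H) m (suc n)
  bound = subst₂ (λ T₃ T₁ → Bound T₃ T₁ m (suc n)) (degSum-full H 3) (degSum-full H 1)
    (EdgeBound.edge-bound inC pos noCycle (suc n) full count-full m
      ((proj₁ largest , refl , refl) , λ x _ → proj₂ largest x))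

best-split : ∀ n → ∃ λ a → ∀ (H : Graph (suc n)) → InNC H → P H ≤ P (split (suc n) a)
best-split n = toℕ (proj₁ choice) , best-max
  where
  choice = argmax (λ a → P (split (suc n) (toℕ a)))
  best-max : ∀ H → InNC H → P H ≤ P (split (suc n) (toℕ (proj₁ choice)))
  best-max H H∈NC with NC-below-split H H∈NC
  ... | m , m≤1+n , P≤ = ≤-trans P≤ (subst (λ a → P (split (suc n) a) ≤ _) (Finₚ.toℕ-fromℕ< (s≤s m≤1+n))
                                            (proj₂ choice (Fin.fromℕ< (s≤s m≤1+n))))

lemma5p15 : ∀ (n : ℕ) → 1 ≤ n →
    Σ (Graph n) (λ G → IsMaximizer InNC G × InW G)
    × (∀ (G : Graph n) → IsMaximizer InW G → IsMaximizer InNC G)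
lemma5p15 (suc n) _ = (best , (InW⇒InNC best∈W , best-max) , best∈W) , W-max⇒NC-max
  where
  a = proj₁ (best-split n)
  best = split (suc n) a
  best∈W = split∈W (suc n) a
  best-max : ∀ H → InNC H → P H ≤ P best
  best-max = proj₂ (best-split n)
  W-max⇒NC-max : ∀ G → IsMaximizer InW G → IsMaximizer InNC G
  W-max⇒NC-max G (G∈W , G-max) = InW⇒InNC G∈W , λ H H∈NC → ≤-trans (best-max H H∈NC) (G-max best best∈W)
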